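{- Let $n\ge 1$ be an integer and let $u\in \mathrm{GF}(2^{2\cdot 3^{n}})$ be nonzero. If $c:=u+u^{ -1}\in \mathrm{GF}(2^{2\cdot 3^{n-1}})$, then $u\in \mathrm{GF}(2^{2\cdot 3^{n-1}})$.
   Context: $\mathrm{GF}(2^m)$ denotes the finite field with $2^m$ elements; all fields are viewed inside a fixed algebraic closure of $\mathrm{GF}(2)$. -}

module Defs where

open import Level using (Level; _⊔_) renaming (suc to lsuc)
open import Algebra.Bundles using (CommutativeRing)
open import Data.Nat using (ℕ; zero; suc; _^_; _≥_)
open import Data.List using (List; []; _∷_)
open import Data.Product using (Σ; ∃; _×_)
open import Relation.Nullary using (¬_)

record Field (c ℓ : Level) : Set (lsuc (c ⊔ ℓ)) where
  field
    commutativeRing : CommutativeRing c ℓ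
  open CommutativeRing commutativeRing public
  field
    0≉1     : ¬ (0# ≈ 1#)
    inverse : ∀ x → ¬ (x ≈ 0#) → ∃ λ y → x * y ≈ 1#

module _ {c ℓ : Level} (F : Field c ℓ) where
  open Field F

  pow : Carrier → ℕ → Carrier
  pow x zero    = 1#
  pow x (suc n) = x * pow x n

  -- value at x of the monic polynomial
  --   X^(d+1) + a₀ X^d + a₁ X^(d-1) + ... + a_d
  -- where (a₀ ∷ ... ∷ a_d) is the given list (Horner scheme, leading coefficient 1).
  hornerFrom : Carrier → List Carrier → Carrier → Carrier
  hornerFrom acc []       x = acc
  hornerFrom acc (a ∷ as) x = hornerFrom (acc * x + a) as x

  evalMonic : List Carrier → Carrier → Carrier
  evalMonic as x = hornerFrom 1# as x

  -- F is an algebraic closure of GF(2):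
  --   * characteristic 2,
  --   * algebraically closed (every monic polynomial of degree ≥ 1 has a root),
  --   * algebraic over GF(2) (every element lies in some finite field GF(2^m), m ≥ 1).
  record IsAlgebraicClosureOfGF2 : Set (c ⊔ ℓ) where
    field
      char2        : 1# + 1# ≈ 0#
      algClosed    : ∀ (a : Carrier) (as : List Carrier) → ∃ λ x → evalMonic (a ∷ as) x ≈ 0#
      algebraic    : ∀ x → ∃ λ m → (m ≥ 1) × (pow x (2 ^ m) ≈ x)

  -- x ∈ GF(2^m) ⊆ F : the unique subfield of order 2^m inside the algebraic
  -- closure, i.e. the set of roots of X^(2^m) - X.
  InGF2^ : ℕ → Carrier → Set ℓ
  InGF2^ m x = pow x (2 ^ m) ≈ x

-- Let q = 2^(2·3^(n-1)) and φ x = x^q, so φ c = c and φ³ u = u. Both u and v = φ u are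
-- roots of X² + cX + 1, hence A = u + v satisfies A² = cA and so A^q = c^(q-1) A.
-- Since c^(q-1) fixes c, squaring gives (A^q + A)² = 0; the field has no nonzero nilpotents
-- (every element is fixed by some x ↦ x^(2^m)), so φ A = A, i.e. v + φ² u = u + v.
-- Thus φ² u = u, and together with φ³ u = u this gives φ u = u.
module Submission where

open import Defs
open import Level using (Level)
open import Algebra.Bundles using (CommutativeRing)
import Data.Nat as ℕ
import Data.Nat.Properties as ℕ
open import Data.Product using (_,_)
import Relation.Binary.PropositionalEquality as ≡

module CommutativeRingPowers {c ℓ} (R : CommutativeRing c ℓ) where
  open CommutativeRing R
  open import Algebra.Properties.CommutativeSemiring.Exp commutativeSemiring public
  open import Algebra.Properties.Monoid.Mult *-monoid using (×-idem)
  open import Algebra.Properties.Group +-group using (inverseˡ-unique; ∙-cancelˡ)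
  open import Relation.Binary.Reasoning.Setoid setoid
  open import Algebra.Solver.Ring.NaturalCoefficients.Default commutativeSemiring
    using (solve; _:+_; _:*_; _:=_; con)

  ^-fixed∧square≈0⇒≈0 : ∀ {x} n → 2 ℕ.≤ n → x ^ n ≈ x → x * x ≈ 0# → x ≈ 0#
  ^-fixed∧square≈0⇒≈0 1 (ℕ.s≤s ())
  ^-fixed∧square≈0⇒≈0 {x} (ℕ.suc (ℕ.suc n)) _ x^n≈x x²≈0 = begin
    x                  ≈⟨ x^n≈x ⟨
    x * (x * x ^ n)    ≈⟨ *-assoc x x (x ^ n) ⟨
    (x * x) * x ^ n    ≈⟨ *-congʳ x²≈0 ⟩
    0# * x ^ n         ≈⟨ zeroˡ (x ^ n) ⟩
    0#                 ∎

  1^n≈1 : ∀ n .{{_ : ℕ.NonZero n}} → 1# ^ n ≈ 1#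
  1^n≈1 = ×-idem (*-identityˡ 1#)

  ^-fixed-by-square∧cube⇒fixed : ∀ q {x} → x ^ (q ℕ.^ 3) ≈ x → (x ^ q) ^ q ≈ x → x ^ q ≈ x
  ^-fixed-by-square∧cube⇒fixed q {x} cube square = begin
    x ^ q                ≈⟨ ^-congˡ q square ⟨
    ((x ^ q) ^ q) ^ q    ≈⟨ ^-congˡ q (^-assocʳ x q q) ⟩
    (x ^ (q ℕ.* q)) ^ q  ≈⟨ ^-assocʳ x (q ℕ.* q) q ⟩
    x ^ (q ℕ.* q ℕ.* q)  ≈⟨ ^-congʳ x q*q*q≡q^3 ⟩
    x ^ (q ℕ.^ 3)        ≈⟨ cube ⟩
    x                    ∎
    where
    q*q*q≡q^3 : q ℕ.* q ℕ.* q ≡.≡ q ℕ.^ 3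
    q*q*q≡q^3 = ≡.trans (ℕ.*-assoc q q q) (≡.cong (λ t → q ℕ.* (q ℕ.* t)) (≡.sym (ℕ.*-identityʳ q)))

  ^-suc≈scalar : ∀ {A a} → A * A ≈ a * A → ∀ m → A ^ ℕ.suc m ≈ a ^ m * A
  ^-suc≈scalar {A} {a} _ ℕ.zero = trans (*-identityʳ A) (sym (*-identityˡ A))
  ^-suc≈scalar {A} {a} A²≈aA (ℕ.suc m) = begin
    A * A ^ ℕ.suc m    ≈⟨ *-congˡ (^-suc≈scalar A²≈aA m) ⟩
    A * (a ^ m * A)    ≈⟨ solve 2 (λ A s → A :* (s :* A) := s :* (A :* A)) refl A (a ^ m) ⟩
    a ^ m * (A * A)    ≈⟨ *-congˡ A²≈aA ⟩
    a ^ m * (a * A)    ≈⟨ *-assoc (a ^ m) a A ⟨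
    (a ^ m * a) * A    ≈⟨ *-congʳ (*-comm (a ^ m) a) ⟩
    a ^ ℕ.suc m * A    ∎

  module Characteristic2 (char2 : 1# + 1# ≈ 0#) where

    x+x≈0 : ∀ x → x + x ≈ 0#
    x+x≈0 x = begin
      x + x          ≈⟨ solve 1 (λ x → x :+ x := x :* (con 1 :+ con 1)) refl x ⟩
      x * (1# + 1#)  ≈⟨ *-congˡ char2 ⟩
      x * 0#         ≈⟨ zeroʳ x ⟩
      0#             ∎

    x+y≈0⇒x≈y : ∀ {x y} → x + y ≈ 0# → x ≈ y
    x+y≈0⇒x≈y {x} {y} x+y≈0 = trans (inverseˡ-unique x y x+y≈0) (sym (inverseˡ-unique y y (x+x≈0 y)))

    square-+ : ∀ x y → (x + y) * (x + y) ≈ x * x + y * y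
    square-+ x y = begin
      (x + y) * (x + y)                    ≈⟨ solve 2 (λ x y → (x :+ y) :* (x :+ y) := (x :* x :+ y :* y) :+ (x :* y :+ x :* y)) refl x y ⟩
      (x * x + y * y) + (x * y + x * y)    ≈⟨ +-congˡ (x+x≈0 (x * y)) ⟩
      (x * x + y * y) + 0#                 ≈⟨ +-identityʳ _ ⟩
      x * x + y * y                        ∎

    ^2^-homo-+ : ∀ k x y → (x + y) ^ (2 ℕ.^ k) ≈ x ^ (2 ℕ.^ k) + y ^ (2 ℕ.^ k)
    ^2^-homo-+ ℕ.zero x y = trans (*-identityʳ (x + y)) (sym (+-cong (*-identityʳ x) (*-identityʳ y)))
    ^2^-homo-+ (ℕ.suc k) x y = begin
      (x + y) ^ (2 ℕ.* q)                  ≈⟨ ^-assocʳ (x + y) 2 q ⟨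
      ((x + y) ^ 2) ^ q                    ≈⟨ ^-congˡ q (trans (square≈^2 (x + y)) (square-+ x y)) ⟩
      (x * x + y * y) ^ q                  ≈⟨ ^2^-homo-+ k (x * x) (y * y) ⟩
      (x * x) ^ q + (y * y) ^ q            ≈⟨ +-cong (^-congˡ q (square≈^2 x)) (^-congˡ q (square≈^2 y)) ⟨
      (x ^ 2) ^ q + (y ^ 2) ^ q            ≈⟨ +-cong (^-assocʳ x 2 q) (^-assocʳ y 2 q) ⟩
      x ^ (2 ℕ.* q) + y ^ (2 ℕ.* q)        ∎
      where
      q = 2 ℕ.^ k
      square≈^2 : ∀ z → z ^ 2 ≈ z * z
      square≈^2 z = *-congˡ (*-identityʳ z)

    root-of-trace : ∀ {x x⁻¹ a} → x + x⁻¹ ≈ a → x * x⁻¹ ≈ 1# → x * x + a * x ≈ 1#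
    root-of-trace {x} {x⁻¹} {a} x+x⁻¹≈a xx⁻¹≈1 = begin
      x * x + a * x                ≈⟨ +-congˡ (*-congʳ x+x⁻¹≈a) ⟨
      x * x + (x + x⁻¹) * x        ≈⟨ solve 2 (λ x y → x :* x :+ (x :+ y) :* x := (x :+ x) :* x :+ x :* y) refl x x⁻¹ ⟩
      (x + x) * x + x * x⁻¹        ≈⟨ +-cong (trans (*-congʳ (x+x≈0 x)) (zeroˡ x)) xx⁻¹≈1 ⟩
      0# + 1#                      ≈⟨ +-identityˡ 1# ⟩
      1#                           ∎

    ^2^-preserves-root : ∀ k {x a} → a ^ (2 ℕ.^ k) ≈ a → x * x + a * x ≈ 1# →
                         let y = x ^ (2 ℕ.^ k) in y * y + a * y ≈ 1#
    ^2^-preserves-root k {x} {a} a-fixed x-root = begin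
      x ^ q * x ^ q + a * x ^ q              ≈⟨ +-congˡ (*-congʳ a-fixed) ⟨
      x ^ q * x ^ q + a ^ q * x ^ q          ≈⟨ +-cong (^-distrib-* x x q) (^-distrib-* a x q) ⟨
      (x * x) ^ q + (a * x) ^ q              ≈⟨ ^2^-homo-+ k (x * x) (a * x) ⟨
      (x * x + a * x) ^ q                    ≈⟨ ^-congˡ q x-root ⟩
      1# ^ q                                 ≈⟨ 1^n≈1 q {{ℕ.m^n≢0 2 k}} ⟩
      1#                                     ∎
      where q = 2 ℕ.^ k

    sum-of-roots : ∀ {x y a} → x * x + a * x ≈ 1# → y * y + a * y ≈ 1# →
                   (x + y) * (x + y) ≈ a * (x + y)
    sum-of-roots {x} {y} {a} x-root y-root = x+y≈0⇒x≈y (begin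
      (x + y) * (x + y) + a * (x + y)                          ≈⟨ solve 3 (λ x y a →
          (x :+ y) :* (x :+ y) :+ a :* (x :+ y) := ((x :* x :+ a :* x) :+ (y :* y :+ a :* y)) :+ (x :* y :+ x :* y)) refl x y a ⟩
      ((x * x + a * x) + (y * y + a * y)) + (x * y + x * y)  ≈⟨ +-cong (+-cong x-root y-root) (x+x≈0 (x * y)) ⟩
      (1# + 1#) + 0#                                         ≈⟨ +-identityʳ _ ⟩
      1# + 1#                                                ≈⟨ char2 ⟩
      0#                                                     ∎)

    module Reduced (reduced : ∀ x → x * x ≈ 0# → x ≈ 0#) where

      scalar-fixing-a-fixes : ∀ {A a s} → A * A ≈ a * A → s * a ≈ a → s * A ≈ A
      scalar-fixing-a-fixes {A} {a} {s} A²≈aA sa≈a = x+y≈0⇒x≈y (reduced (s * A + A) (begin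
        (s * A + A) * (s * A + A)    ≈⟨ square-+ (s * A) A ⟩
        (s * A) * (s * A) + A * A    ≈⟨ +-congʳ sA²≈A² ⟩
        A * A + A * A                ≈⟨ x+x≈0 (A * A) ⟩
        0#                           ∎))
        where
        sA²≈A² : (s * A) * (s * A) ≈ A * A
        sA²≈A² = begin
          (s * A) * (s * A)  ≈⟨ solve 2 (λ s A → (s :* A) :* (s :* A) := s :* (s :* (A :* A))) refl s A ⟩
          s * (s * (A * A))  ≈⟨ *-congˡ (*-congˡ A²≈aA) ⟩
          s * (s * (a * A))  ≈⟨ *-congˡ (*-assoc s a A) ⟨
          s * ((s * a) * A)  ≈⟨ *-congˡ (*-congʳ sa≈a) ⟩
          s * (a * A)        ≈⟨ *-assoc s a A ⟨
          (s * a) * A        ≈⟨ *-congʳ sa≈a ⟩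
          a * A              ≈⟨ A²≈aA ⟨
          A * A              ∎

      ^-fixed-if-scalar-fixed : ∀ {A a} → A * A ≈ a * A → ∀ n .{{_ : ℕ.NonZero n}} → a ^ n ≈ a → A ^ n ≈ A
      ^-fixed-if-scalar-fixed {A} {a} A²≈aA (ℕ.suc m) a-fixed =
        trans (^-suc≈scalar A²≈aA m) (scalar-fixing-a-fixes A²≈aA (trans (*-comm (a ^ m) a) a-fixed))

      trace-fixed⇒fixed : ∀ k {u u⁻¹} → let q = 2 ℕ.^ k in
                          u * u⁻¹ ≈ 1# → (u + u⁻¹) ^ q ≈ u + u⁻¹ → u ^ (q ℕ.^ 3) ≈ u → u ^ q ≈ u
      trace-fixed⇒fixed k {u} {u⁻¹} uu⁻¹≈1 trace-fixed cube = ^-fixed-by-square∧cube⇒fixed q cube square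
        where
        q = 2 ℕ.^ k
        a = u + u⁻¹
        v = u ^ q
        u-root : u * u + a * u ≈ 1#
        u-root = root-of-trace refl uu⁻¹≈1
        A²≈aA : (u + v) * (u + v) ≈ a * (u + v)
        A²≈aA = sum-of-roots u-root (^2^-preserves-root k trace-fixed u-root)
        v+v^q≈v+u : v + v ^ q ≈ v + u
        v+v^q≈v+u = begin
          v + v ^ q      ≈⟨ ^2^-homo-+ k u v ⟨
          (u + v) ^ q    ≈⟨ ^-fixed-if-scalar-fixed A²≈aA q {{ℕ.m^n≢0 2 k}} trace-fixed ⟩
          u + v          ≈⟨ +-comm u v ⟩
          v + u          ∎
        square : (u ^ q) ^ q ≈ u
        square = ∙-cancelˡ v (v ^ q) u v+v^q≈v+u

module AlgebraicClosureOfGF2 {c ℓ : Level} (F : Field c ℓ) (H : IsAlgebraicClosureOfGF2 F) where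
  open Field F
  open IsAlgebraicClosureOfGF2 H
  open CommutativeRingPowers (Field.commutativeRing F)
  open Characteristic2 char2
  open import Relation.Binary.Reasoning.Setoid setoid

  pow≈^ : ∀ x n → pow F x n ≈ x ^ n
  pow≈^ x ℕ.zero    = refl
  pow≈^ x (ℕ.suc n) = *-congˡ (pow≈^ x n)

  reduced : ∀ x → x * x ≈ 0# → x ≈ 0#
  reduced x with algebraic x
  ... | m , m≥1 , x^2^m≈x =
    ^-fixed∧square≈0⇒≈0 (2 ℕ.^ m) (ℕ.^-monoʳ-≤ 2 m≥1) (trans (sym (pow≈^ x (2 ℕ.^ m))) x^2^m≈x)

  open Reduced reduced

  InGF2^-of-trace : ∀ m {u u⁻¹} → u * u⁻¹ ≈ 1# → InGF2^ F (2 ℕ.* 3 ℕ.^ m) (u + u⁻¹) →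
                    InGF2^ F (2 ℕ.* 3 ℕ.^ ℕ.suc m) u → InGF2^ F (2 ℕ.* 3 ℕ.^ m) u
  InGF2^-of-trace m {u} {u⁻¹} uu⁻¹≈1 trace∈ u∈ = trans (pow≈^ u q) (trace-fixed⇒fixed k uu⁻¹≈1 trace-fixed cube)
    where
    k = 2 ℕ.* 3 ℕ.^ m
    q = 2 ℕ.^ k
    trace-fixed : (u + u⁻¹) ^ q ≈ u + u⁻¹
    trace-fixed = trans (sym (pow≈^ (u + u⁻¹) q)) trace∈
    3k≡2·3^[1+m] : k ℕ.* 3 ≡.≡ 2 ℕ.* 3 ℕ.^ ℕ.suc m
    3k≡2·3^[1+m] = ≡.trans (ℕ.*-assoc 2 (3 ℕ.^ m) 3) (≡.cong (2 ℕ.*_) (ℕ.*-comm (3 ℕ.^ m) 3))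
    cube : u ^ (q ℕ.^ 3) ≈ u
    cube = begin
      u ^ (q ℕ.^ 3)                        ≡⟨ ≡.cong (u ^_) (ℕ.^-*-assoc 2 k 3) ⟩
      u ^ (2 ℕ.^ (k ℕ.* 3))                ≡⟨ ≡.cong (λ e → u ^ (2 ℕ.^ e)) 3k≡2·3^[1+m] ⟩
      u ^ (2 ℕ.^ (2 ℕ.* 3 ℕ.^ ℕ.suc m))    ≈⟨ pow≈^ u (2 ℕ.^ (2 ℕ.* 3 ℕ.^ ℕ.suc m)) ⟨
      pow F u (2 ℕ.^ (2 ℕ.* 3 ℕ.^ ℕ.suc m)) ≈⟨ u∈ ⟩
      u                                    ∎

open import Data.Nat using (ℕ; _*_; _^_; _≥_; _∸_)
open import Relation.Nullary using (¬_)

lemma2p3 : ∀ {c ℓ : Level} (F : Field c ℓ) → IsAlgebraicClosureOfGF2 F →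
    let open Field F renaming (_*_ to _·_) in
    ∀ (n : ℕ) → n ≥ 1 →
    ∀ (u u⁻¹ : Carrier) → InGF2^ F (2 * 3 ^ n) u → ¬ (u ≈ 0#) → u · u⁻¹ ≈ 1# →
    InGF2^ F (2 * 3 ^ (n ∸ 1)) (u + u⁻¹) →
    InGF2^ F (2 * 3 ^ (n ∸ 1)) u
-- u ≉ 0 is implied by u · u⁻¹ ≈ 1.
lemma2p3 F H (ℕ.suc m) _ u u⁻¹ u∈ _ uu⁻¹≈1 trace∈ = AlgebraicClosureOfGF2.InGF2^-of-trace F H m uu⁻¹≈1 trace∈ u∈
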